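{- Let $\dot{\mathcal C}$ be a colored chain on vertices $Z_1\subset Z_2\subset\dots\subset Z_t$ with colors $c_1,\dots,c_t$, and fix a $\dot{\mathcal C}$-free coloring of a Boolean lattice $\mathcal Q=\mathcal Q(\mathcal Z)$. Let $2\le i\le t$. Then: (i) every $Z\in\Phi_1$ has color $\bar c_1$; (ii) if $c_i\neq c_{i-1}$, then every $Z\in\Phi_i$ has color $\bar c_i$; (iii) if $c_i=c_{i-1}$, then every vertex in $M_i$ has color $c_i$, and every vertex in $\Phi_i\setminus M_i$ has color $\bar c_i$.
   Context: $\mathcal Q(\mathcal Z)$ is the Boolean lattice of all subsets of a finite set $\mathcal Z$ ordered by inclusion; for $A\subseteq B$ in $\mathcal Q$, $\mathcal Q|_A^B=\{X: A\subseteq X\subseteq B\}$. An (induced) copy of a poset $P$ in $\mathcal Q$ is a subset which, with the inherited order, is isomorphic to $P$. A colored poset is a poset with each vertex colored blue or red; a copy of a colored poset in a colored $\mathcal Q$ is an induced copy in which every vertex has the same color as the corresponding vertex; a coloring is $\dot P$-free if it contains no copy of $\dot P$. For the colored chain $\dot{\mathcal C}$ with $i$-th vertex of color $c_i$, $\bar c_i$ denotes the other color, $\dot{\mathcal C}[i]$ denotes the colored subchain on $Z_1,\dots,Z_i$ (and $\dot{\mathcal C}[0]$ is empty). For $X\in\mathcal Q$, the phase is $\varphi(X)=\max\{i\in[t+1]:\ \text{the coloring of } \mathcal Q|_\varnothing^X \text{ contains a copy of } \dot{\mathcal C}[i-1]\}$. $\Phi_i=\{X\in\mathcal Q:\varphi(X)=i\}$,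 and $M_i$ is the set of minimal elements of $\Phi_i$ (with respect to inclusion). -}

module Defs where

open import Data.Nat using (ℕ; _≤_; _<_; suc)
open import Data.Fin.Subset using (Subset; _⊆_; _⊂_; ⊤)
open import Data.Product using (Σ; _×_)
open import Relation.Binary.PropositionalEquality using (_≡_)
open import Relation.Nullary using (¬_)

data Color : Set where
  blue red : Color

flip : Color → Color
flip blue = red
flip red  = blue

Coloring : ℕ → Set
Coloring n = Subset n → Color

-- A colored chain with t vertices is given by its colors c₁,…,c_t,
-- encoded as c : ℕ → Color, 1-based (only c 1 … c t are used).
-- A copy of the colored subchain C[k] (vertices 1..k) inside the
-- sublattice Q|_∅^X : subsets S 1 ⊂ S 2 ⊂ … ⊂ S k, all ⊆ X, with
-- color (S j) = c j.  (An induced copy of a chain is exactly a strictly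
-- increasing sequence of sets.)
CopyBelow : {n : ℕ} → Coloring n → (ℕ → Color) → ℕ → Subset n → Set
CopyBelow {n} col c k X =
  Σ (ℕ → Subset n) λ S →
    (∀ j → 1 ≤ j → j ≤ k → S j ⊆ X × col (S j) ≡ c j) ×
    (∀ j j' → 1 ≤ j → j < j' → j' ≤ k → S j ⊂ S j')

Free : {n : ℕ} → Coloring n → (ℕ → Color) → ℕ → Set
Free col c t = ¬ CopyBelow col c t ⊤

-- φ(X) = i, where φ(X) = max{ i ∈ [t+1] : Q|_∅^X contains a copy of C[i-1] }.
-- (C[i-1] with i = suc m is C[m].)
PhaseIs : {n : ℕ} → Coloring n → (ℕ → Color) → ℕ → Subset n → ℕ → Set
PhaseIs col c t X i =
  Σ ℕ λ m → (i ≡ suc m) × (m ≤ t) × CopyBelow col c m X ×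
    (∀ m' → m' ≤ t → CopyBelow col c m' X → m' ≤ m)

InM : {n : ℕ} → Coloring n → (ℕ → Color) → ℕ → ℕ → Subset n → Set
InM col c t i X =
  PhaseIs col c t X i × (∀ Y → PhaseIs col c t Y i → Y ⊆ X → Y ≡ X)

{-# OPTIONS --safe #-}
-- A set Z of phase i = m + 1 ≤ t contains a copy of C[m] but, by maximality of the
-- phase, no copy of C[m + 1]. So if Z had color cᵢ, no copy of C[m] could lie
-- strictly below Z, since appending Z would extend it. Hence a Z of color cᵢ is the
-- top vertex of its copy (forcing cᵢ = cᵢ₋₁) and is minimal in Φᵢ; conversely a
-- minimal Z is the top of its copy, of color cᵢ₋₁.
module Submission where

open import Defs
open import Data.Nat using (ℕ; _≤_; _∸_; _<_; suc; z≤n; s≤s; _≤?_)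
open import Data.Nat.Properties using (≤-refl; ≤-trans; ≤-antisym; ≰⇒>; m≤n⇒m<n∨m≡n; n≮n; suc-injective; ≤-pred)
open import Data.Fin.Subset using (Subset; _⊆_; _⊂_)
open import Data.Fin.Subset.Properties using (_⊂?_; _∈?_; ⊆-refl; ⊆-trans; ⊆-antisym; ⊆-⊂-trans)
open import Data.Product using (_×_; _,_; proj₁; proj₂)
open import Data.Sum using (_⊎_; inj₁; inj₂)
open import Data.Empty using (⊥-elim)
open import Relation.Binary.PropositionalEquality using (_≡_; _≢_; refl; sym; cong; module ≡-Reasoning)
open import Relation.Nullary using (¬_; yes; no)

≢⇒≡flip : ∀ {a b : Color} → a ≢ b → a ≡ flip b
≢⇒≡flip {blue} {blue} a≢b = ⊥-elim (a≢b refl)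
≢⇒≡flip {blue} {red}  _   = refl
≢⇒≡flip {red}  {blue} _   = refl
≢⇒≡flip {red}  {red}  a≢b = ⊥-elim (a≢b refl)

⊆⇒⊂⊎≡ : ∀ {n} {p q : Subset n} → p ⊆ q → p ⊂ q ⊎ p ≡ q
⊆⇒⊂⊎≡ {p = p} {q} p⊆q with p ⊂? q
... | yes p⊂q = inj₁ p⊂q
... | no  p⊄q = inj₂ (⊆-antisym p⊆q q⊆p)
  where
  q⊆p : q ⊆ p
  q⊆p {x} x∈q with x ∈? p
  ... | yes x∈p = x∈p
  ... | no  x∉p = ⊥-elim (p⊄q (p⊆q , x , x∈q , x∉p))

module _ {n : ℕ} (col : Coloring n) (c : ℕ → Color) where

  vertex : ∀ {k X} → CopyBelow col c k X → ℕ → Subset n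
  vertex = proj₁

  vertex-⊆ : ∀ {k X} (cp : CopyBelow col c k X) {j} → 1 ≤ j → j ≤ k → vertex cp j ⊆ X
  vertex-⊆ (_ , below , _) 1≤j j≤k = proj₁ (below _ 1≤j j≤k)

  vertex-color : ∀ {k X} (cp : CopyBelow col c k X) {j} → 1 ≤ j → j ≤ k → col (vertex cp j) ≡ c j
  vertex-color (_ , below , _) 1≤j j≤k = proj₂ (below _ 1≤j j≤k)

  vertex-⊆-last : ∀ {k X} (cp : CopyBelow col c k X) {j} → 1 ≤ j → j ≤ k → vertex cp j ⊆ vertex cp k
  vertex-⊆-last (_ , _ , chain) 1≤j j≤k with m≤n⇒m<n∨m≡n j≤k
  ... | inj₁ j<k  = proj₁ (chain _ _ 1≤j j<k ≤-refl)
  ... | inj₂ refl = ⊆-refl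

  CopyBelow-zero : ∀ X → CopyBelow col c 0 X
  CopyBelow-zero X = (λ _ → X) , (λ { _ (s≤s _) () }) , (λ { _ _ (s≤s _) (s≤s _) () })

  CopyBelow-mono : ∀ {k X Y} → X ⊆ Y → CopyBelow col c k X → CopyBelow col c k Y
  CopyBelow-mono X⊆Y cp@(S , _ , chain) =
    S , (λ _ 1≤j j≤k → ⊆-trans (vertex-⊆ cp 1≤j j≤k) X⊆Y , vertex-color cp 1≤j j≤k) , chain

  CopyBelow-last : ∀ {k X} (cp : CopyBelow col c k X) → CopyBelow col c k (vertex cp k)
  CopyBelow-last cp@(S , _ , chain) =
    S , (λ _ 1≤j j≤k → vertex-⊆-last cp 1≤j j≤k , vertex-color cp 1≤j j≤k) , chain

  CopyBelow-extend : ∀ {m W Z} (cp : CopyBelow col c m W) →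
    (∀ j → 1 ≤ j → j ≤ m → vertex cp j ⊂ Z) → col Z ≡ c (suc m) → CopyBelow col c (suc m) Z
  CopyBelow-extend {m} {Z = Z} cp vertex⊂Z colZ = T , below , chain
    where
    T : ℕ → Subset n
    T j with j ≤? m
    ... | yes _ = vertex cp j
    ... | no  _ = Z

    below : ∀ j → 1 ≤ j → j ≤ suc m → T j ⊆ Z × col (T j) ≡ c j
    below j 1≤j j≤1+m with j ≤? m
    ... | yes j≤m = proj₁ (vertex⊂Z j 1≤j j≤m) , vertex-color cp 1≤j j≤m
    ... | no  j≰m with ≤-antisym j≤1+m (≰⇒> j≰m)
    ...   | refl = ⊆-refl , colZ

    chain : ∀ j j' → 1 ≤ j → j < j' → j' ≤ suc m → T j ⊂ T j'
    chain j j' 1≤j j<j' j'≤1+m with j ≤? m | j' ≤? m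
    ... | yes _   | yes j'≤m = proj₂ (proj₂ cp) j j' 1≤j j<j' j'≤m
    ... | yes j≤m | no  _    = vertex⊂Z j 1≤j j≤m
    ... | no  j≰m | _        = ⊥-elim (j≰m (≤-pred (≤-trans j<j' j'≤1+m)))

  CopyBelow-extend-⊂ : ∀ {m Y Z} → CopyBelow col c m Y → Y ⊂ Z → col Z ≡ c (suc m) →
    CopyBelow col c (suc m) Z
  CopyBelow-extend-⊂ cp Y⊂Z =
    CopyBelow-extend cp (λ _ 1≤j j≤m → ⊆-⊂-trans (vertex-⊆ cp 1≤j j≤m) Y⊂Z)

  module _ (t : ℕ) where

    PhaseIs-copy : ∀ {m Z} → PhaseIs col c t Z (suc m) → CopyBelow col c m Z
    PhaseIs-copy (_ , eq , _ , cp , _) with suc-injective eq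
    ... | refl = cp

    PhaseIs-maximal : ∀ {m Z} → PhaseIs col c t Z (suc m) → suc m ≤ t → ¬ CopyBelow col c (suc m) Z
    PhaseIs-maximal {m} (_ , eq , _ , _ , maximal) 1+m≤t cp with suc-injective eq
    ... | refl = n≮n m (maximal (suc m) 1+m≤t cp)

    PhaseIs-⊆ : ∀ {m Y Z} → Y ⊆ Z → CopyBelow col c m Y →
      PhaseIs col c t Z (suc m) → PhaseIs col c t Y (suc m)
    PhaseIs-⊆ Y⊆Z cpY (_ , eq , m≤t , _ , maximal) with suc-injective eq
    ... | refl = _ , refl , m≤t , cpY , λ m' m'≤t cp' → maximal m' m'≤t (CopyBelow-mono Y⊆Z cp')

    PhaseIs-no-extension : ∀ {m Y Z} → PhaseIs col c t Z (suc m) → suc m ≤ t →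
      CopyBelow col c m Y → Y ⊂ Z → col Z ≢ c (suc m)
    PhaseIs-no-extension ph 1+m≤t cp Y⊂Z colZ =
      PhaseIs-maximal ph 1+m≤t (CopyBelow-extend-⊂ cp Y⊂Z colZ)

    phase-one-color : ∀ {Z} → 1 ≤ t → PhaseIs col c t Z 1 → col Z ≡ flip (c 1)
    phase-one-color {Z} 1≤t ph = ≢⇒≡flip λ colZ →
      PhaseIs-maximal ph 1≤t (CopyBelow-extend (CopyBelow-zero Z) (λ { _ (s≤s _) () }) colZ)

    phase-last-vertex : ∀ {m Z} (ph : PhaseIs col c t Z (suc m)) → 1 ≤ m → suc m ≤ t →
      col Z ≡ c (suc m) → vertex (PhaseIs-copy ph) m ≡ Z
    phase-last-vertex {m} ph 1≤m 1+m≤t colZ with ⊆⇒⊂⊎≡ (vertex-⊆ (PhaseIs-copy ph) 1≤m ≤-refl)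
    ... | inj₁ Sₘ⊂Z =
      ⊥-elim (PhaseIs-no-extension ph 1+m≤t (CopyBelow-last (PhaseIs-copy ph)) Sₘ⊂Z colZ)
    ... | inj₂ Sₘ≡Z = Sₘ≡Z

    phase-color-change : ∀ {m Z} → 1 ≤ m → suc m ≤ t → c (suc m) ≢ c m →
      PhaseIs col c t Z (suc m) → col Z ≡ flip (c (suc m))
    phase-color-change {m} {Z} 1≤m 1+m≤t c≢ ph = ≢⇒≡flip λ colZ → c≢ (begin
      c (suc m)         ≡⟨ sym colZ ⟩
      col Z             ≡⟨ cong col (sym (phase-last-vertex ph 1≤m 1+m≤t colZ)) ⟩
      col (vertex cp m) ≡⟨ vertex-color cp 1≤m ≤-refl ⟩
      c m               ∎)
      where
      open ≡-Reasoning
      cp : CopyBelow col c m Z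
      cp = PhaseIs-copy ph

    minimal-color : ∀ {m Z} → 1 ≤ m → c (suc m) ≡ c m →
      InM col c t (suc m) Z → col Z ≡ c (suc m)
    minimal-color {m} {Z} 1≤m c≡ (ph , minimal) = begin
      col Z             ≡⟨ cong col (sym Sₘ≡Z) ⟩
      col (vertex cp m) ≡⟨ vertex-color cp 1≤m ≤-refl ⟩
      c m               ≡⟨ sym c≡ ⟩
      c (suc m)         ∎
      where
      open ≡-Reasoning
      cp : CopyBelow col c m Z
      cp = PhaseIs-copy ph
      Sₘ⊆Z : vertex cp m ⊆ Z
      Sₘ⊆Z = vertex-⊆ cp 1≤m ≤-refl
      Sₘ≡Z : vertex cp m ≡ Z
      Sₘ≡Z = minimal _ (PhaseIs-⊆ Sₘ⊆Z (CopyBelow-last cp) ph) Sₘ⊆Z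

    non-minimal-color : ∀ {m Z} → 1 ≤ m → suc m ≤ t → PhaseIs col c t Z (suc m) →
      ¬ InM col c t (suc m) Z → col Z ≡ flip (c (suc m))
    non-minimal-color {m} {Z} 1≤m 1+m≤t ph Z∉M =
      ≢⇒≡flip λ colZ → Z∉M (ph , λ _ phY Y⊆Z → Y≡Z colZ phY Y⊆Z)
      where
      Y≡Z : ∀ {Y} → col Z ≡ c (suc m) → PhaseIs col c t Y (suc m) → Y ⊆ Z → Y ≡ Z
      Y≡Z colZ phY Y⊆Z with ⊆⇒⊂⊎≡ Y⊆Z
      ... | inj₁ Y⊂Z = ⊥-elim (PhaseIs-no-extension ph 1+m≤t (PhaseIs-copy phY) Y⊂Z colZ)
      ... | inj₂ Y≡Z = Y≡Z

proposition1 : (n t : ℕ) (c : ℕ → Color) (col : Coloring n) →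
    Free col c t → (i : ℕ) → 2 ≤ i → i ≤ t →
    (∀ (Z : Subset n) → PhaseIs col c t Z 1 → col Z ≡ flip (c 1)) ×
    (c i ≢ c (i ∸ 1) → ∀ (Z : Subset n) → PhaseIs col c t Z i → col Z ≡ flip (c i)) ×
    (c i ≡ c (i ∸ 1) →
      (∀ (Z : Subset n) → InM col c t i Z → col Z ≡ c i) ×
      (∀ (Z : Subset n) → PhaseIs col c t Z i → ¬ InM col c t i Z → col Z ≡ flip (c i)))
proposition1 n t c col _ (suc m) (s≤s 1≤m) 1+m≤t =
  (λ _ → phase-one-color col c t (≤-trans (s≤s z≤n) 1+m≤t)) ,
  (λ c≢ _ → phase-color-change col c t 1≤m 1+m≤t c≢) ,
  (λ c≡ → (λ _ → minimal-color col c t 1≤m c≡) , (λ _ → non-minimal-color col c t 1≤m 1+m≤t))
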